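{- Let $M=(E,G)\in\mathcal E_3$ with $\chi(M)\ge3$. Then for every hyperplane $H$ of $G$, the matroid $M$ is a semidoubling of $M|H$.
   Context: A simple binary matroid (here just "matroid") is a pair $M=(E,G)$, where $G$ is identified with $\mathbb F_2^n\setminus\{0\}$ and $E\subseteq G$. A flat of $G$ is a set $V\setminus\{0\}$ with $V$ a subspace, of dimension $\dim V$; a hyperplane is a flat of dimension $n-1$; $M|H=(E\cap H,H)$. The critical number $\chi(M)$ is the smallest $k\ge0$ such that $G\setminus E$ contains a flat of dimension $n-k$. $\mathcal E_3$ is the class of matroids $(E,G)$ with $|E\cap F|$ even for every flat $F$ of dimension at least $3$. $M$ is a semidoubling of $M|H$ if there are $w\in G\setminus(H\cup E)$ and a hyperplane $H_0$ of $H$ with $E=(E\cap H)\cup\{w+x:x\in(E\cap H)\triangle(H\setminus H_0)\}$. -}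

module Defs where

open import Data.Bool using (Bool; true; false; _∧_; _∨_; not; _xor_; if_then_else_)
open import Data.Nat using (ℕ; zero; suc; _∸_; _≤_; _<_)
open import Data.Nat.Divisibility using (_∣_)
open import Data.Vec using (Vec; []; _∷_; replicate; zipWith)
open import Data.List using (List; []; _∷_; _++_; map)
open import Data.Bool.ListAction using (any)
open import Data.Product using (Σ; ∃; _×_; _,_)
open import Data.Sum using (_⊎_)
open import Relation.Nullary using (¬_)
open import Relation.Binary.PropositionalEquality using (_≡_; _≢_)

-- Points of F₂ⁿ are Bool vectors (true = 1); addition is coordinatewise xor.
V : ℕ → Set
V n = Vec Bool n

0v : ∀ {n} → V n
0v = replicate _ false

_⊕_ : ∀ {n} → V n → V n → V n
_⊕_ = zipWith _xor_

allVec : (n : ℕ) → List (V n)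
allVec zero = [] ∷ []
allVec (suc n) = map (false ∷_) (allVec n) ++ map (true ∷_) (allVec n)

_==ᵇ_ : ∀ {n} → V n → V n → Bool
[] ==ᵇ [] = true
(a ∷ x) ==ᵇ (b ∷ y) = not (a xor b) ∧ (x ==ᵇ y)

comb : ∀ {n k} → Vec (V n) k → V k → V n
comb [] [] = 0v
comb (b ∷ bs) (c ∷ cs) = (if c then b else 0v) ⊕ comb bs cs

Independent : ∀ {n k} → Vec (V n) k → Set
Independent {k = k} b = ∀ c → comb b c ≡ 0v → c ≡ replicate k false

InSpan : ∀ {n k} → Vec (V n) k → V n → Set
InSpan {k = k} b x = ∃ λ (c : V k) → comb b c ≡ x

-- A flat of dimension k is  span(b) ∖ {0}  for a linearly independent family b
-- of k vectors (a basis of the subspace).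
InFlat : ∀ {n k} → Vec (V n) k → V n → Set
InFlat b x = InSpan b x × x ≢ 0v

inFlatᵇ : ∀ {n k} → Vec (V n) k → V n → Bool
inFlatᵇ {k = k} b x = any (λ c → comb b c ==ᵇ x) (allVec k) ∧ not (x ==ᵇ 0v)

-- A simple binary matroid M = (E, G) with G = F₂ⁿ ∖ {0}: E is given by its
-- characteristic function on F₂ⁿ, required to avoid 0 (E ⊆ G).
record Matroid (n : ℕ) : Set where
  field
    E    : V n → Bool
    E-0  : E 0v ≡ false
open Matroid public

countᵇ : ∀ {A : Set} → (A → Bool) → List A → ℕ
countᵇ p [] = 0
countᵇ p (x ∷ xs) = if p x then suc (countᵇ p xs) else countᵇ p xs

cardEF : ∀ {n k} → Matroid n → Vec (V n) k → ℕ
cardEF M b = countᵇ (λ x → E M x ∧ inFlatᵇ b x) (allVec _)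

In𝓔₃ : ∀ {n} → Matroid n → Set
In𝓔₃ {n} M = ∀ (k : ℕ) → 3 ≤ k → (b : Vec (V n) k) → Independent b → 2 ∣ cardEF M b

HasFlatAvoidingE : ∀ {n} → Matroid n → ℕ → Set
HasFlatAvoidingE {n} M d =
  Σ (Vec (V n) d) λ b → Independent b × (∀ x → InFlat b x → E M x ≡ false)

ChiAtLeast3 : ∀ {n} → Matroid n → Set
ChiAtLeast3 {n} M = ∀ (k : ℕ) → k < 3 → k ≤ n → ¬ HasFlatAvoidingE M (n ∸ k)

-- M is a semidoubling of M|H, where H = span(h) ∖ {0} is a hyperplane of G
-- (h independent with n − 1 elements): there are w ∈ G ∖ (H ∪ E) and a
-- hyperplane H₀ = span(h₀) ∖ {0} of H (h₀ independent, n − 2 elements, inside H) with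
--   E = (E ∩ H) ∪ { w + y : y ∈ (E ∩ H) △ (H ∖ H₀) }.
IsSemidoublingOf : ∀ {n} → Matroid n → Vec (V n) (n ∸ 1) → Set
IsSemidoublingOf {n} M h =
  Σ (V n) λ w →
  Σ (Vec (V n) (n ∸ 2)) λ h₀ →
      w ≢ 0v × ¬ InFlat h w × E M w ≡ false
    × Independent h₀ × (∀ x → InFlat h₀ x → InFlat h x)
    × (∀ x → (E M x ≡ true) ⇔ ((E M x ≡ true × InFlat h x)
                                ⊎ (∃ λ y → x ≡ w ⊕ y × InSymDiff h h₀ y)))
  where
    _⇔_ : Set → Set → Set
    A ⇔ B = (A → B) × (B → A)
    InSymDiff : Vec (V n) (n ∸ 1) → Vec (V n) (n ∸ 2) → V n → Set
    InSymDiff h h₀ y =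
        ((E M y ≡ true × InFlat h y) × ¬ (InFlat h y × ¬ InFlat h₀ y))
      ⊎ (¬ (E M y ≡ true × InFlat h y) × (InFlat h y × ¬ InFlat h₀ y))

-- Let H = span h, pick u ∉ H and identify H with F₂ᵐ through ι = comb h; write
-- E₀ s = [ι s ∈ E] and E₁ s = [u + ι s ∈ E]. On the 3-flat spanned by u + ι a, ι p
-- and ι q, the parity condition of 𝓔₃ says exactly that the defect
--   δₐ s = E₁ a + E₀ s + E₁ (a + s)
-- is a linear functional of s. If some a with u + ι a ∉ E has δₐ ≠ 0, then
-- w = u + ι a and H₀ = ι (ker δₐ) exhibit M as a semidoubling of M|H, because
-- w + ι s ∈ E iff E₀ s + δₐ s = 1. Otherwise E₀ is linear (if E₁ ≡ 1) or its zero set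
-- is a subspace (if E₁ a₀ = 0), and each possible codimension of that subspace yields
-- either a flat of codimension at most 2 avoiding E, against χ(M) ≥ 3, or a 3-flat of
-- H all of whose seven points lie in E, against 𝓔₃.

module Submission where

open import Defs
open import Data.Bool using (Bool; true; false; _∧_; _∨_; not; _xor_; if_then_else_)
open import Data.Bool.Solver using (module xor-∧-Solver)
open import Data.Bool.ListAction using (any)
open import Data.Bool.Properties
  using (xor-assoc; xor-comm; xor-identityˡ; xor-identityʳ; xor-same; ∧-zeroʳ; ∧-identityʳ; ∧-distribˡ-xor; ¬-not)
  renaming (_≟_ to _≟ᵇ_)
open import Data.Nat using (ℕ; zero; suc; _+_; _*_; _∸_; _^_; _≤_; z≤n; s≤s; parity)
open import Data.Nat.Divisibility using (_∣_; divides)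
open import Data.Parity using (Parity; 0ℙ; 1ℙ; _⁻¹)
import Data.Parity as ℙ
open import Data.Parity.Properties using (⁻¹-selfInverse; suc-homo-⁻¹; *-homo-*; p≢p⁻¹)
import Data.Parity.Properties as ℙ
open import Data.Nat.Properties using (1+n≰n; n∸n≡0; n≤1+n; ≤-refl; +-suc; +-identityʳ; ≤-trans; ≮⇒≥; <⇒≱; ^-monoʳ-<)
open import Data.List using (List; []; _∷_; _++_; map; length; [_])
open import Data.List.Properties using (length-++; length-map)
open import Data.List.Membership.Propositional using (_∈_; lose)
open import Data.List.Membership.Propositional.Properties
  using (∈-map⁺; ∈-map⁻; ∈-++⁺ˡ; ∈-++⁺ʳ; ∈-++⁻; ∈-∃++)
open import Data.List.Relation.Unary.All using ([]) renaming (lookup to All-lookup)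
open import Data.List.Relation.Unary.Any using (here; there; any?; satisfied)
open import Data.List.Relation.Unary.Unique.Propositional using (Unique; []; _∷_)
import Data.List.Relation.Unary.Unique.Propositional.Properties as Unique
open import Data.Vec using (Vec; []; _∷_) renaming (_++_ to _++ᵥ_)
open import Data.Vec.Properties
  using (≡-dec; ∷-injectiveˡ; ∷-injectiveʳ; zipWith-comm; zipWith-assoc; zipWith-identityˡ; zipWith-identityʳ)
open import Data.Product using (∃; _×_; _,_; proj₁; proj₂)
open import Data.Sum using (_⊎_; inj₁; inj₂)
open import Data.Empty using (⊥; ⊥-elim)
open import Relation.Nullary using (¬_; Dec; yes; no)
open import Relation.Nullary.Decidable using (map′; does; dec-true; _×-dec_)
open import Relation.Unary using (Decidable)
open import Relation.Binary.Definitions using (DecidableEquality)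
open import Relation.Binary.PropositionalEquality hiding ([_])
open import Function using (id; _∘_; _⇔_; mk⇔; Equivalence)
open xor-∧-Solver using (solve; _:+_; _:=_)

-- Booleans, vectors of F₂ⁿ and linear combinations

true≢false : true ≢ false
true≢false ()

not≡true⇒≡false : ∀ {b} → not b ≡ true → b ≡ false
not≡true⇒≡false {false} _ = refl

not≡false⇒≡true : ∀ {b} → not b ≡ false → b ≡ true
not≡false⇒≡true {true} _ = refl

xor-cancelˡ : ∀ x y → x xor (x xor y) ≡ y
xor-cancelˡ = solve 2 (λ x y → x :+ (x :+ y) := y) refl

xor≡false⇒≡ : ∀ {x y} → x xor y ≡ false → x ≡ y
xor≡false⇒≡ {true} {true} _ = refl
xor≡false⇒≡ {false} {false} _ = refl

_≟ᵥ_ : ∀ {n} → DecidableEquality (V n)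
_≟ᵥ_ = ≡-dec _≟ᵇ_

⊕-comm : ∀ {n} (x y : V n) → x ⊕ y ≡ y ⊕ x
⊕-comm = zipWith-comm xor-comm

⊕-assoc : ∀ {n} (x y z : V n) → (x ⊕ y) ⊕ z ≡ x ⊕ (y ⊕ z)
⊕-assoc = zipWith-assoc xor-assoc

⊕-identityˡ : ∀ {n} (x : V n) → 0v ⊕ x ≡ x
⊕-identityˡ = zipWith-identityˡ xor-identityˡ

⊕-identityʳ : ∀ {n} (x : V n) → x ⊕ 0v ≡ x
⊕-identityʳ = zipWith-identityʳ xor-identityʳ

⊕-self : ∀ {n} (x : V n) → x ⊕ x ≡ 0v
⊕-self [] = refl
⊕-self (a ∷ x) = cong₂ _∷_ (xor-same a) (⊕-self x)

⊕-cancelˡ : ∀ {n} (x y : V n) → x ⊕ (x ⊕ y) ≡ y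
⊕-cancelˡ x y = begin
  x ⊕ (x ⊕ y) ≡⟨ ⊕-assoc x x y ⟨
  (x ⊕ x) ⊕ y ≡⟨ cong (_⊕ y) (⊕-self x) ⟩
  0v ⊕ y      ≡⟨ ⊕-identityˡ y ⟩
  y           ∎
  where open ≡-Reasoning

⊕-cancelʳ : ∀ {n} (x y : V n) → (x ⊕ y) ⊕ y ≡ x
⊕-cancelʳ x y = begin
  (x ⊕ y) ⊕ y ≡⟨ ⊕-assoc x y y ⟩
  x ⊕ (y ⊕ y) ≡⟨ cong (x ⊕_) (⊕-self y) ⟩
  x ⊕ 0v      ≡⟨ ⊕-identityʳ x ⟩
  x           ∎
  where open ≡-Reasoning

⊕≡0⇒≡ : ∀ {n} (x y : V n) → x ⊕ y ≡ 0v → x ≡ y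
⊕≡0⇒≡ x y eq = begin
  x            ≡⟨ ⊕-identityʳ x ⟨
  x ⊕ 0v       ≡⟨ cong (x ⊕_) eq ⟨
  x ⊕ (x ⊕ y)  ≡⟨ ⊕-cancelˡ x y ⟩
  y            ∎
  where open ≡-Reasoning

⊕-interchange : ∀ {n} (a b c d : V n) → (a ⊕ b) ⊕ (c ⊕ d) ≡ (a ⊕ c) ⊕ (b ⊕ d)
⊕-interchange a b c d = begin
  (a ⊕ b) ⊕ (c ⊕ d) ≡⟨ ⊕-assoc a b (c ⊕ d) ⟩
  a ⊕ (b ⊕ (c ⊕ d)) ≡⟨ cong (a ⊕_) (⊕-assoc b c d) ⟨
  a ⊕ ((b ⊕ c) ⊕ d) ≡⟨ cong (λ t → a ⊕ (t ⊕ d)) (⊕-comm b c) ⟩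
  a ⊕ ((c ⊕ b) ⊕ d) ≡⟨ cong (a ⊕_) (⊕-assoc c b d) ⟩
  a ⊕ (c ⊕ (b ⊕ d)) ≡⟨ ⊕-assoc a c (b ⊕ d) ⟨
  (a ⊕ c) ⊕ (b ⊕ d) ∎
  where open ≡-Reasoning

==ᵇ-refl : ∀ {n} (x : V n) → (x ==ᵇ x) ≡ true
==ᵇ-refl [] = refl
==ᵇ-refl (true ∷ x) = ==ᵇ-refl x
==ᵇ-refl (false ∷ x) = ==ᵇ-refl x

==ᵇ-sound : ∀ {n} {x y : V n} → (x ==ᵇ y) ≡ true → x ≡ y
==ᵇ-sound {x = []} {[]} _ = refl
==ᵇ-sound {x = true ∷ x} {true ∷ y} eq = cong (true ∷_) (==ᵇ-sound eq)
==ᵇ-sound {x = false ∷ x} {false ∷ y} eq = cong (false ∷_) (==ᵇ-sound eq)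

==ᵇ-complete : ∀ {n} {x y : V n} → x ≢ y → (x ==ᵇ y) ≡ false
==ᵇ-complete {x = x} {y} x≢y with x ==ᵇ y in eq
... | true = ⊥-elim (x≢y (==ᵇ-sound eq))
... | false = refl

scale : ∀ {n} → Bool → V n → V n
scale c x = if c then x else 0v

scale-xor : ∀ {n} c d (x : V n) → scale (c xor d) x ≡ scale c x ⊕ scale d x
scale-xor true true x = sym (⊕-self x)
scale-xor true false x = sym (⊕-identityʳ x)
scale-xor false true x = sym (⊕-identityˡ x)
scale-xor false false x = sym (⊕-identityˡ 0v)

record IsLinear {n m} (f : V n → V m) : Set where
  field
    map-0v : f 0v ≡ 0v
    map-⊕ : ∀ x y → f (x ⊕ y) ≡ f x ⊕ f y

  map-scale : ∀ c x → f (scale c x) ≡ scale c (f x)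
  map-scale true x = refl
  map-scale false x = map-0v

comb-0v : ∀ {n k} (b : Vec (V n) k) → comb b 0v ≡ 0v
comb-0v [] = refl
comb-0v (x ∷ b) = trans (⊕-identityˡ _) (comb-0v b)

comb-⊕ : ∀ {n k} (b : Vec (V n) k) c d → comb b (c ⊕ d) ≡ comb b c ⊕ comb b d
comb-⊕ [] [] [] = sym (⊕-identityˡ 0v)
comb-⊕ (x ∷ b) (c ∷ cs) (d ∷ ds) =
  trans (cong₂ _⊕_ (scale-xor c d x) (comb-⊕ b cs ds))
        (⊕-interchange (scale c x) (scale d x) (comb b cs) (comb b ds))

comb-isLinear : ∀ {n k} (b : Vec (V n) k) → IsLinear (comb b)
comb-isLinear b = record { map-0v = comb-0v b ; map-⊕ = comb-⊕ b }

comb-map : ∀ {n m k} {f : V n → V m} → IsLinear f → (b : Vec (V n) k) (c : V k) →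
           comb (Data.Vec.map f b) c ≡ f (comb b c)
comb-map lin [] [] = sym (IsLinear.map-0v lin)
comb-map {f = f} lin (x ∷ b) (c ∷ cs) = begin
  scale c (f x) ⊕ comb (Data.Vec.map f b) cs ≡⟨ cong₂ _⊕_ (sym (map-scale c x)) (comb-map lin b cs) ⟩
  f (scale c x) ⊕ f (comb b cs)              ≡⟨ sym (map-⊕ (scale c x) (comb b cs)) ⟩
  f (scale c x ⊕ comb b cs)                  ∎
  where open ≡-Reasoning
        open IsLinear lin

comb-injective : ∀ {n k} (b : Vec (V n) k) → Independent b → ∀ {c d} → comb b c ≡ comb b d → c ≡ d
comb-injective b ind {c} {d} eq =
  ⊕≡0⇒≡ c d (ind (c ⊕ d) (trans (comb-⊕ b c d) (trans (cong (_⊕ comb b d) eq) (⊕-self (comb b d)))))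

module _ {n} (p q : V n) where

  comb-10 : comb (p ∷ q ∷ []) (true ∷ false ∷ []) ≡ p
  comb-10 = trans (cong (p ⊕_) (⊕-identityˡ 0v)) (⊕-identityʳ p)

  comb-01 : comb (p ∷ q ∷ []) (false ∷ true ∷ []) ≡ q
  comb-01 = trans (⊕-identityˡ _) (⊕-identityʳ q)

  comb-11 : comb (p ∷ q ∷ []) (true ∷ true ∷ []) ≡ p ⊕ q
  comb-11 = cong (p ⊕_) (⊕-identityʳ q)

  independent-pair : p ≢ 0v → q ≢ 0v → p ≢ q → Independent (p ∷ q ∷ [])
  independent-pair p≢0 q≢0 p≢q (false ∷ false ∷ []) _ = refl
  independent-pair p≢0 q≢0 p≢q (true ∷ false ∷ []) p≡0 = ⊥-elim (p≢0 (trans (sym comb-10) p≡0))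
  independent-pair p≢0 q≢0 p≢q (false ∷ true ∷ []) q≡0 = ⊥-elim (q≢0 (trans (sym comb-01) q≡0))
  independent-pair p≢0 q≢0 p≢q (true ∷ true ∷ []) p⊕q≡0 = ⊥-elim (p≢q (⊕≡0⇒≡ p q (trans (sym comb-11) p⊕q≡0)))

liftᵥ : ∀ {m k} → Vec (V m) k → Vec (V (suc m)) k
liftᵥ = Data.Vec.map (false ∷_)

comb-liftᵥ : ∀ {m k} (K : Vec (V m) k) c → comb (liftᵥ K) c ≡ false ∷ comb K c
comb-liftᵥ = comb-map (record { map-0v = refl ; map-⊕ = λ _ _ → refl })

comb-++ : ∀ {n k l} (K : Vec (V n) k) (L : Vec (V n) l) c d → comb (K ++ᵥ L) (c ++ᵥ d) ≡ comb K c ⊕ comb L d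
comb-++ [] L [] d = sym (⊕-identityˡ (comb L d))
comb-++ (x ∷ K) L (c₀ ∷ c) d = trans (cong (scale c₀ x ⊕_) (comb-++ K L c d)) (sym (⊕-assoc (scale c₀ x) _ _))

-- Enumerating F₂ⁿ

allVec-complete : ∀ {n} (x : V n) → x ∈ allVec n
allVec-complete [] = here refl
allVec-complete {suc n} (false ∷ x) = ∈-++⁺ˡ (∈-map⁺ (false ∷_) (allVec-complete x))
allVec-complete {suc n} (true ∷ x) = ∈-++⁺ʳ (map (false ∷_) (allVec n)) (∈-map⁺ (true ∷_) (allVec-complete x))

allVec-unique : ∀ n → Unique (allVec n)
allVec-unique zero = [] ∷ []
allVec-unique (suc n) =
  Unique.++⁺ (Unique.map⁺ ∷-injectiveʳ (allVec-unique n)) (Unique.map⁺ ∷-injectiveʳ (allVec-unique n)) disjoint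
  where
  disjoint : ∀ {x} → ¬ (x ∈ map (false ∷_) (allVec n) × x ∈ map (true ∷_) (allVec n))
  disjoint (p , q) with ∈-map⁻ (false ∷_) p | ∈-map⁻ (true ∷_) q
  ... | _ , _ , refl | _ , _ , ()

allVec-length : ∀ n → length (allVec n) ≡ 2 ^ n
allVec-length zero = refl
allVec-length (suc n) = begin
  length (map (false ∷_) (allVec n) ++ map (true ∷_) (allVec n))
    ≡⟨ length-++ (map (false ∷_) (allVec n)) ⟩
  length (map (false ∷_) (allVec n)) + length (map (true ∷_) (allVec n))
    ≡⟨ cong₂ _+_ (length-map (false ∷_) (allVec n)) (length-map (true ∷_) (allVec n)) ⟩
  length (allVec n) + length (allVec n)
    ≡⟨ cong (λ t → t + t) (allVec-length n) ⟩
  2 ^ n + 2 ^ n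
    ≡⟨ cong (2 ^ n +_) (+-identityʳ (2 ^ n)) ⟨
  2 ^ suc n ∎
  where open ≡-Reasoning

does-sound : ∀ {A : Set} (a? : Dec A) → does a? ≡ true → A
does-sound (yes a) _ = a

∃ᵥ? : ∀ {n} {P : V n → Set} → Decidable P → Dec (∃ P)
∃ᵥ? {n} P? = map′ satisfied (λ (x , px) → lose (allVec-complete x) px) (any? P? (allVec n))

unique-⊆⇒length≤ : ∀ {A : Set} {xs ys : List A} → Unique xs → (∀ {x} → x ∈ xs → x ∈ ys) →
                   length xs ≤ length ys
unique-⊆⇒length≤ {xs = []} _ _ = z≤n
unique-⊆⇒length≤ {xs = x ∷ xs} (x∉xs ∷ unique) xs⊆ys with ∈-∃++ (xs⊆ys (here refl))
... | ys₁ , ys₂ , refl =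
  subst (suc (length xs) ≤_) (sym length-split) (s≤s (unique-⊆⇒length≤ unique xs⊆ys₁++ys₂))
  where
  length-split : length (ys₁ ++ [ x ] ++ ys₂) ≡ suc (length (ys₁ ++ ys₂))
  length-split = trans (length-++ ys₁) (trans (+-suc (length ys₁) (length ys₂)) (cong suc (sym (length-++ ys₁))))
  xs⊆ys₁++ys₂ : ∀ {z} → z ∈ xs → z ∈ ys₁ ++ ys₂
  xs⊆ys₁++ys₂ z∈xs with ∈-++⁻ ys₁ (xs⊆ys (there z∈xs))
  ... | inj₁ p = ∈-++⁺ˡ p
  ... | inj₂ (here refl) = ⊥-elim (All-lookup x∉xs z∈xs refl)
  ... | inj₂ (there p) = ∈-++⁺ʳ ys₁ p

2^-cancel-≤ : ∀ {m n} → 2 ^ m ≤ 2 ^ n → m ≤ n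
2^-cancel-≤ 2^m≤2^n = ≮⇒≥ λ n<m → <⇒≱ (^-monoʳ-< 2 (s≤s (s≤s z≤n)) n<m) 2^m≤2^n

independent⇒≤ : ∀ {n k} {b : Vec (V n) k} → Independent b → k ≤ n
independent⇒≤ {n} {k} {b} ind = 2^-cancel-≤ (subst₂ _≤_
  (trans (length-map (comb b) (allVec k)) (allVec-length k)) (allVec-length n)
  (unique-⊆⇒length≤ (Unique.map⁺ (comb-injective b ind) (allVec-unique k)) (λ _ → allVec-complete _)))

spanning⇒≥ : ∀ {n k} {b : Vec (V n) k} → (∀ x → InSpan b x) → n ≤ k
spanning⇒≥ {n} {k} {b} spans = 2^-cancel-≤ (subst₂ _≤_
  (allVec-length n) (trans (length-map (comb b) (allVec k)) (allVec-length k))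
  (unique-⊆⇒length≤ (allVec-unique n) λ {x} _ →
    subst (_∈ map (comb b) (allVec k)) (proj₂ (spans x)) (∈-map⁺ (comb b) (allVec-complete (proj₁ (spans x))))))

-- Sums in F₂

xorSum : ∀ {A : Set} → (A → Bool) → List A → Bool
xorSum f [] = false
xorSum f (x ∷ xs) = f x xor xorSum f xs

module _ {A : Set} where

  xorSum-cong : ∀ {f g : A → Bool} → (∀ x → f x ≡ g x) → ∀ xs → xorSum f xs ≡ xorSum g xs
  xorSum-cong f≗g [] = refl
  xorSum-cong f≗g (x ∷ xs) = cong₂ _xor_ (f≗g x) (xorSum-cong f≗g xs)

  xorSum-xor : ∀ (f g : A → Bool) xs → xorSum (λ x → f x xor g x) xs ≡ xorSum f xs xor xorSum g xs
  xorSum-xor f g [] = refl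
  xorSum-xor f g (x ∷ xs) rewrite xorSum-xor f g xs =
    solve 4 (λ a b c d → (a :+ b) :+ (c :+ d) := (a :+ c) :+ (b :+ d)) refl (f x) (g x) (xorSum f xs) (xorSum g xs)

  xorSum-++ : ∀ (f : A → Bool) xs ys → xorSum f (xs ++ ys) ≡ xorSum f xs xor xorSum f ys
  xorSum-++ f [] ys = refl
  xorSum-++ f (x ∷ xs) ys = trans (cong (f x xor_) (xorSum-++ f xs ys)) (sym (xor-assoc (f x) _ _))

  xorSum-map : ∀ {B : Set} (g : B → A) (f : A → Bool) xs → xorSum f (map g xs) ≡ xorSum (λ y → f (g y)) xs
  xorSum-map g f [] = refl
  xorSum-map g f (x ∷ xs) = cong (f (g x) xor_) (xorSum-map g f xs)

  xorSum-false : ∀ {f : A → Bool} {xs} → (∀ {x} → x ∈ xs → f x ≡ false) → xorSum f xs ≡ false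
  xorSum-false {xs = []} _ = refl
  xorSum-false {xs = x ∷ xs} all-false = cong₂ _xor_ (all-false (here refl)) (xorSum-false (all-false ∘ there))

  any-false : ∀ {f : A → Bool} {xs} → (∀ {x} → x ∈ xs → f x ≡ false) → any f xs ≡ false
  any-false {xs = []} _ = refl
  any-false {xs = x ∷ xs} all-false = cong₂ _∨_ (all-false (here refl)) (any-false (all-false ∘ there))

xorSum-allVec-suc : ∀ {k} (f : V (suc k) → Bool) →
  xorSum f (allVec (suc k)) ≡ xorSum (λ c → f (false ∷ c)) (allVec k) xor xorSum (λ c → f (true ∷ c)) (allVec k)
xorSum-allVec-suc {k} f = trans (xorSum-++ f (map (false ∷_) (allVec k)) _)
  (cong₂ _xor_ (xorSum-map (false ∷_) f (allVec k)) (xorSum-map (true ∷_) f (allVec k)))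

module _ {n} (q : V n → Bool) where

  xorSum-δ : ∀ {v} {xs : List (V n)} → Unique xs → v ∈ xs → xorSum (λ x → q x ∧ (v ==ᵇ x)) xs ≡ q v
  xorSum-δ {v} {_ ∷ xs} (v∉xs ∷ _) (here refl) = begin
    (q v ∧ (v ==ᵇ v)) xor xorSum (λ x → q x ∧ (v ==ᵇ x)) xs
      ≡⟨ cong₂ (λ a b → (q v ∧ a) xor b) (==ᵇ-refl v) (xorSum-false λ y∈xs →
           trans (cong (q _ ∧_) (==ᵇ-complete (All-lookup v∉xs y∈xs))) (∧-zeroʳ _)) ⟩
    (q v ∧ true) xor false ≡⟨ trans (xor-identityʳ _) (∧-identityʳ (q v)) ⟩
    q v                    ∎
    where open ≡-Reasoning
  xorSum-δ {v} {x ∷ xs} (x∉xs ∷ unique) (there v∈xs) = begin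
    (q x ∧ (v ==ᵇ x)) xor xorSum (λ x → q x ∧ (v ==ᵇ x)) xs
      ≡⟨ cong (_xor _) (trans (cong (q x ∧_) (==ᵇ-complete (All-lookup x∉xs v∈xs ∘ sym))) (∧-zeroʳ _)) ⟩
    xorSum (λ x → q x ∧ (v ==ᵇ x)) xs ≡⟨ xorSum-δ unique v∈xs ⟩
    q v                               ∎
    where open ≡-Reasoning

  xorSum-image : ∀ {k} (f : V k → V n) → (∀ {c d} → f c ≡ f d → c ≡ d) → ∀ {cs} → Unique cs →
    xorSum (λ x → q x ∧ any (λ c → f c ==ᵇ x) cs) (allVec n) ≡ xorSum (λ c → q (f c)) cs
  xorSum-image f inj [] = xorSum-false {f = λ x → q x ∧ false} {allVec n} (λ _ → ∧-zeroʳ _)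
  xorSum-image f inj {c ∷ cs} (c∉cs ∷ unique) = begin
    xorSum (λ x → q x ∧ ((f c ==ᵇ x) ∨ hit x)) (allVec n)
      ≡⟨ xorSum-cong (λ x → trans (cong (q x ∧_) (∨≡xor (disjoint x))) (∧-distribˡ-xor (q x) _ _)) (allVec n) ⟩
    xorSum (λ x → (q x ∧ (f c ==ᵇ x)) xor (q x ∧ hit x)) (allVec n)
      ≡⟨ xorSum-xor (λ x → q x ∧ (f c ==ᵇ x)) (λ x → q x ∧ hit x) (allVec n) ⟩
    xorSum (λ x → q x ∧ (f c ==ᵇ x)) (allVec n) xor xorSum (λ x → q x ∧ hit x) (allVec n)
      ≡⟨ cong₂ _xor_ (xorSum-δ (allVec-unique n) (allVec-complete (f c))) (xorSum-image f inj unique) ⟩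
    q (f c) xor xorSum (λ c → q (f c)) cs ∎
    where
    open ≡-Reasoning
    hit : V n → Bool
    hit x = any (λ c → f c ==ᵇ x) cs
    disjoint : ∀ x → (f c ==ᵇ x) ≡ true → hit x ≡ false
    disjoint x fc≡x = any-false λ d∈cs → ==ᵇ-complete λ fd≡x →
      All-lookup c∉cs d∈cs (inj (trans (==ᵇ-sound fc≡x) (sym fd≡x)))
    ∨≡xor : ∀ {a b} → (a ≡ true → b ≡ false) → a ∨ b ≡ a xor b
    ∨≡xor {true} {true} excl = excl refl
    ∨≡xor {true} {false} _ = refl
    ∨≡xor {false} _ = refl

toParity : Bool → Parity
toParity false = 0ℙ
toParity true = 1ℙ

parity-countᵇ : ∀ {A : Set} (p : A → Bool) xs → parity (countᵇ p xs) ≡ toParity (xorSum p xs)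
parity-countᵇ p [] = refl
parity-countᵇ p (x ∷ xs) with p x
... | false = parity-countᵇ p xs
... | true = trans (sym (⁻¹-selfInverse (suc-homo-⁻¹ (countᵇ p xs))))
                   (trans (cong _⁻¹ (parity-countᵇ p xs)) (toParity-not (xorSum p xs)))
  where
  toParity-not : ∀ b → toParity b ⁻¹ ≡ toParity (not b)
  toParity-not false = refl
  toParity-not true = refl

even-countᵇ : ∀ {A : Set} (p : A → Bool) xs → 2 ∣ countᵇ p xs → xorSum p xs ≡ false
even-countᵇ p xs (divides q count≡q*2) with xorSum p xs | parity-countᵇ p xs
... | false | _ = refl
... | true | count-odd = ⊥-elim (p≢p⁻¹ 1ℙ (begin
  1ℙ                    ≡⟨ count-odd ⟨
  parity (countᵇ p xs)  ≡⟨ cong parity count≡q*2 ⟩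
  parity (q * 2)        ≡⟨ *-homo-* q 2 ⟩
  parity q ℙ.* 0ℙ       ≡⟨ ℙ.*-zeroʳ (parity q) ⟩
  0ℙ                    ∎))
  where open ≡-Reasoning

-- The sum runs over all of span b, 0 included, which is harmless since 0 ∉ E.
flat-parity : ∀ {n k} (M : Matroid n) (b : Vec (V n) k) → Independent b → 2 ∣ cardEF M b →
              xorSum (λ c → E M (comb b c)) (allVec k) ≡ false
flat-parity {n} {k} M b ind even = begin
  xorSum (λ c → E M (comb b c)) (allVec k)
    ≡⟨ xorSum-image (E M) (comb b) (comb-injective b ind) (allVec-unique k) ⟨
  xorSum (λ x → E M x ∧ any (λ c → comb b c ==ᵇ x) (allVec k)) (allVec n)
    ≡⟨ xorSum-cong E∧inFlatᵇ (allVec n) ⟨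
  xorSum (λ x → E M x ∧ inFlatᵇ b x) (allVec n)
    ≡⟨ even-countᵇ _ (allVec n) even ⟩
  false ∎
  where
  open ≡-Reasoning
  E∧inFlatᵇ : ∀ x → (E M x ∧ inFlatᵇ b x) ≡ (E M x ∧ any (λ c → comb b c ==ᵇ x) (allVec k))
  E∧inFlatᵇ x with x ≟ᵥ 0v
  ... | yes refl rewrite E-0 M = refl
  ... | no x≢0 rewrite ==ᵇ-complete x≢0 = cong (E M x ∧_) (∧-identityʳ _)

xorSum-span-pair : ∀ {n} (g : V n → Bool) (p q : V n) →
  xorSum (λ c → g (comb (p ∷ q ∷ []) c)) (allVec 2) ≡ g 0v xor (g q xor (g p xor g (p ⊕ q)))
xorSum-span-pair g p q =
  cong₂ _xor_ (cong g (comb-0v (p ∷ q ∷ [])))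
    (cong₂ _xor_ (cong g (comb-01 p q))
      (cong₂ _xor_ (cong g (comb-10 p q)) (trans (xor-identityʳ _) (cong g (comb-11 p q)))))

xorSum-nonzero₃ : (f : V 3 → Bool) → f 0v ≡ false → (∀ c → c ≢ 0v → f c ≡ true) → xorSum f (allVec 3) ≡ true
xorSum-nonzero₃ f f0 f≢0
  rewrite f0
        | f≢0 (false ∷ false ∷ true ∷ []) (λ ()) | f≢0 (false ∷ true ∷ false ∷ []) (λ ())
        | f≢0 (false ∷ true ∷ true ∷ []) (λ ()) | f≢0 (true ∷ false ∷ false ∷ []) (λ ())
        | f≢0 (true ∷ false ∷ true ∷ []) (λ ()) | f≢0 (true ∷ true ∷ false ∷ []) (λ ())
        | f≢0 (true ∷ true ∷ true ∷ []) (λ ()) = refl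

-- Subspaces and their codimension

record IsSubspace {m} (Z : V m → Bool) : Set where
  field
    0v∈ : Z 0v ≡ true
    ⊕-closed : ∀ {x y} → Z x ≡ true → Z y ≡ true → Z (x ⊕ y) ≡ true

record Basis {m} (Z : V m → Bool) (r : ℕ) : Set where
  field
    vectors : Vec (V m) r
    independent : Independent vectors
    ⊆Z : ∀ c → Z (comb vectors c) ≡ true
    spans : ∀ x → Z x ≡ true → InSpan vectors x

record CodimOne {m} (Z : V m → Bool) : Set where
  field
    {dim} : ℕ
    suc-dim : suc dim ≡ m
    basis : Basis Z dim
    complement : V m
    complement∉ : Z complement ≡ false
    covers : ∀ x → Z x ≡ true ⊎ Z (x ⊕ complement) ≡ true

data Codimension {m} (Z : V m → Bool) : Set where
  codim0 : Basis Z m → (∀ x → Z x ≡ true) → Codimension Z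
  codim1 : CodimOne Z → Codimension Z
  codim2 : ∀ {r} → suc (suc r) ≡ m → Basis Z r →
           (p q : V m) → Z p ≡ false → Z q ≡ false → Z (p ⊕ q) ≡ false → Codimension Z
  codim≥3 : (t : Vec (V m) 3) → (∀ c → c ≢ 0v → Z (comb t c) ≡ false) → Codimension Z

module _ {m} {Z : V m → Bool} where

  pair-span-outside : ∀ {p q} → Z p ≡ false → Z q ≡ false → Z (p ⊕ q) ≡ false →
                      ∀ c → c ≢ 0v → Z (comb (p ∷ q ∷ []) c) ≡ false
  pair-span-outside p∉ q∉ p⊕q∉ (false ∷ false ∷ []) c≢0 = ⊥-elim (c≢0 refl)
  pair-span-outside {p} {q} p∉ q∉ p⊕q∉ (true ∷ false ∷ []) _ = trans (cong Z (comb-10 p q)) p∉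
  pair-span-outside {p} {q} p∉ q∉ p⊕q∉ (false ∷ true ∷ []) _ = trans (cong Z (comb-01 p q)) q∉
  pair-span-outside {p} {q} p∉ q∉ p⊕q∉ (true ∷ true ∷ []) _ = trans (cong Z (comb-11 p q)) p⊕q∉

  OutsidePair : Set
  OutsidePair = ∃ λ p → ∃ λ q → Z p ≡ false × Z q ≡ false × Z (p ⊕ q) ≡ false

  codim≤1 : ¬ OutsidePair → Codimension Z → (∀ x → Z x ≡ true) ⊎ CodimOne Z
  codim≤1 _ (codim0 _ all) = inj₁ all
  codim≤1 _ (codim1 H) = inj₂ H
  codim≤1 ¬pair (codim2 _ _ p q p∉ q∉ p⊕q∉) = ⊥-elim (¬pair (p , q , p∉ , q∉ , p⊕q∉))
  codim≤1 ¬pair (codim≥3 t outside) = ⊥-elim (¬pair (comb t e₁ , comb t e₂ , outside e₁ (λ ()) , outside e₂ (λ ()) ,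
    trans (cong Z (sym (comb-⊕ t e₁ e₂))) (outside (e₁ ⊕ e₂) (λ ()))))
    where
    e₁ e₂ : V 3
    e₁ = true ∷ false ∷ false ∷ []
    e₂ = false ∷ true ∷ false ∷ []

module _ {m} {Z : V (suc m) → Bool} (Z-sub : IsSubspace Z) where
  open IsSubspace Z-sub

  Z↓ : V m → Bool
  Z↓ x = Z (false ∷ x)

  Z↓-subspace : IsSubspace Z↓
  Z↓-subspace = record { 0v∈ = 0v∈ ; ⊕-closed = ⊕-closed }

  lift-basis : (∀ t → Z (true ∷ t) ≡ false) → ∀ {r} → Basis Z↓ r → Basis Z r
  lift-basis none B = record
    { vectors = liftᵥ K
    ; independent = λ c eq → independent c (∷-injectiveʳ (trans (sym (comb-liftᵥ K c)) eq))
    ; ⊆Z = λ c → trans (cong Z (comb-liftᵥ K c)) (⊆Z c)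
    ; spans = spans↑
    }
    where
    open Basis B renaming (vectors to K)
    spans↑ : ∀ x → Z x ≡ true → InSpan (liftᵥ K) x
    spans↑ (false ∷ x) x∈ = let c , eq = spans x x∈ in c , trans (comb-liftᵥ K c) (cong (false ∷_) eq)
    spans↑ (true ∷ x) x∈ = ⊥-elim (true≢false (trans (sym x∈) (none x)))

  lift-outside : (t : Vec (V m) 3) → (∀ c → c ≢ 0v → Z↓ (comb t c) ≡ false) →
                 ∀ c → c ≢ 0v → Z (comb (liftᵥ t) c) ≡ false
  lift-outside t outside c c≢0 = trans (cong Z (comb-liftᵥ t c)) (outside c c≢0)

  module _ {t} (t∈ : Z (true ∷ t) ≡ true) where

    raise : ∀ {v} → Z↓ (t ⊕ v) ≡ true → Z (true ∷ v) ≡ true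
    raise {v} h = subst (λ w → Z (true ∷ w) ≡ true) (⊕-cancelˡ t v) (⊕-closed t∈ h)

    extend-basis : ∀ {r} → Basis Z↓ r → Basis Z (suc r)
    extend-basis B = record
      { vectors = (true ∷ t) ∷ liftᵥ K
      ; independent = independent↑
      ; ⊆Z = ⊆Z↑
      ; spans = spans↑
      }
      where
      open Basis B renaming (vectors to K)
      comb-extended : ∀ c₀ c → comb ((true ∷ t) ∷ liftᵥ K) (c₀ ∷ c) ≡ scale c₀ (true ∷ t) ⊕ (false ∷ comb K c)
      comb-extended c₀ c = cong (scale c₀ (true ∷ t) ⊕_) (comb-liftᵥ K c)
      independent↑ : Independent ((true ∷ t) ∷ liftᵥ K)
      independent↑ (true ∷ c) eq = ⊥-elim (true≢false (∷-injectiveˡ (trans (sym (comb-extended true c)) eq)))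
      independent↑ (false ∷ c) eq =
        cong (false ∷_) (independent c (trans (sym (⊕-identityˡ _)) (∷-injectiveʳ (trans (sym (comb-extended false c)) eq))))
      ⊆Z↑ : ∀ c → Z (comb ((true ∷ t) ∷ liftᵥ K) c) ≡ true
      ⊆Z↑ (true ∷ c) = trans (cong Z (comb-extended true c)) (⊕-closed t∈ (⊆Z c))
      ⊆Z↑ (false ∷ c) = trans (cong Z (comb-extended false c)) (⊕-closed 0v∈ (⊆Z c))
      spans↑ : ∀ x → Z x ≡ true → InSpan ((true ∷ t) ∷ liftᵥ K) x
      spans↑ (false ∷ x) x∈ = let c , eq = spans x x∈ in
        (false ∷ c) , trans (comb-extended false c) (cong (false ∷_) (trans (⊕-identityˡ _) eq))
      spans↑ (true ∷ x) x∈ = let c , eq = spans (t ⊕ x) (⊕-closed t∈ x∈) in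
        (true ∷ c) , trans (comb-extended true c) (cong (true ∷_) (trans (cong (t ⊕_) eq) (⊕-cancelˡ t x)))

    classify-through : Codimension Z↓ → Codimension Z
    classify-through (codim0 B all) = codim0 (extend-basis B) all↑
      where
      all↑ : ∀ x → Z x ≡ true
      all↑ (false ∷ x) = all x
      all↑ (true ∷ x) = raise (all _)
    classify-through (codim1 H) = codim1 record
      { suc-dim = cong suc suc-dim
      ; basis = extend-basis basis
      ; complement = false ∷ complement
      ; complement∉ = complement∉
      ; covers = covers↑
      }
      where
      open CodimOne H
      covers↑ : ∀ x → Z x ≡ true ⊎ Z (x ⊕ (false ∷ complement)) ≡ true
      covers↑ (false ∷ x) = covers x
      covers↑ (true ∷ x) with covers (t ⊕ x)
      ... | inj₁ h = inj₁ (raise h)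
      ... | inj₂ h = inj₂ (raise (subst (λ w → Z↓ w ≡ true) (⊕-assoc t x complement) h))
    classify-through (codim2 e B p q p∉ q∉ p⊕q∉) =
      codim2 (cong suc e) (extend-basis B) (false ∷ p) (false ∷ q) p∉ q∉ p⊕q∉
    classify-through (codim≥3 s outside) = codim≥3 (liftᵥ s) (lift-outside s outside)

  module _ (none : ∀ t → Z (true ∷ t) ≡ false) where

    classify-flat : Codimension Z↓ → Codimension Z
    classify-flat (codim0 B all) = codim1 record
      { suc-dim = refl
      ; basis = lift-basis none B
      ; complement = true ∷ 0v
      ; complement∉ = none 0v
      ; covers = covers
      }
      where
      covers : ∀ x → Z x ≡ true ⊎ Z (x ⊕ (true ∷ 0v)) ≡ true
      covers (false ∷ x) = inj₁ (all x)
      covers (true ∷ x) = inj₂ (all (x ⊕ 0v))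
    classify-flat (codim1 H) =
      codim2 (cong suc suc-dim) (lift-basis none basis) (true ∷ 0v) (false ∷ complement)
        (none 0v) complement∉ (none (0v ⊕ complement))
      where open CodimOne H
    classify-flat (codim2 _ _ p q p∉ q∉ p⊕q∉) = codim≥3 ((true ∷ 0v) ∷ liftᵥ (p ∷ q ∷ [])) outside
      where
      outside : ∀ c → c ≢ 0v → Z (comb ((true ∷ 0v) ∷ liftᵥ (p ∷ q ∷ [])) c) ≡ false
      outside (true ∷ c) _ = trans (cong (λ w → Z ((true ∷ 0v) ⊕ w)) (comb-liftᵥ (p ∷ q ∷ []) c)) (none _)
      outside (false ∷ c) c≢0 =
        trans (cong Z (trans (cong (0v ⊕_) (comb-liftᵥ (p ∷ q ∷ []) c)) (cong (false ∷_) (⊕-identityˡ _))))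
              (pair-span-outside {Z = Z↓} p∉ q∉ p⊕q∉ c (c≢0 ∘ cong (false ∷_)))
    classify-flat (codim≥3 s outside) = codim≥3 (liftᵥ s) (lift-outside s outside)

-- Induction on m: classify the slice Z↓ = Z ∩ {x₀ = 0}; then Z either meets {x₀ = 1},
-- gaining one dimension over Z↓, or not, gaining one codimension.
classify : ∀ {m} {Z : V m → Bool} → IsSubspace Z → Codimension Z
classify {zero} Z-sub = codim0 basis (λ { [] → 0v∈ })
  where
  open IsSubspace Z-sub
  basis : Basis _ 0
  basis = record { vectors = [] ; independent = λ { [] _ → refl } ; ⊆Z = λ { [] → 0v∈ } ; spans = λ { [] _ → [] , refl } }
classify {suc m} {Z} Z-sub with ∃ᵥ? (λ t → Z (true ∷ t) ≟ᵇ true)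
... | yes (t , t∈) = classify-through Z-sub t∈ (classify (Z↓-subspace Z-sub))
... | no none = classify-flat Z-sub (λ t → ¬-not (none ∘ (t ,_))) (classify (Z↓-subspace Z-sub))

-- Linear functionals and hyperplanes

IsLinearFunctional : ∀ {m} → (V m → Bool) → Set
IsLinearFunctional f = ∀ p q → f (p ⊕ q) ≡ f p xor f q

linear-from-independent-pairs : ∀ {m} {f : V m → Bool} → f 0v ≡ false →
  (∀ {p q} → Independent (p ∷ q ∷ []) → f (p ⊕ q) ≡ f p xor f q) → IsLinearFunctional f
linear-from-independent-pairs {f = f} f0 additive p q with p ≟ᵥ 0v | q ≟ᵥ 0v | p ≟ᵥ q
... | yes refl | _ | _ = trans (cong f (⊕-identityˡ q)) (cong (_xor f q) (sym f0))
... | no _ | yes refl | _ = trans (cong f (⊕-identityʳ p)) (sym (trans (cong (f p xor_) f0) (xor-identityʳ (f p))))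
... | no _ | no _ | yes refl = trans (cong f (⊕-self p)) (trans f0 (sym (xor-same (f p))))
... | no p≢0 | no q≢0 | no p≢q = additive (independent-pair p q p≢0 q≢0 p≢q)

kernel : ∀ {m} → (V m → Bool) → V m → Bool
kernel f s = not (f s)

module _ {m} {f : V m → Bool} (linear : IsLinearFunctional f) where

  linear-0v : f 0v ≡ false
  linear-0v = begin
    f 0v              ≡⟨ cong f (⊕-self 0v) ⟨
    f (0v ⊕ 0v)       ≡⟨ linear 0v 0v ⟩
    f 0v xor f 0v     ≡⟨ xor-same (f 0v) ⟩
    false             ∎
    where open ≡-Reasoning

  kernel-subspace : IsSubspace (kernel f)
  kernel-subspace = record
    { 0v∈ = cong not linear-0v
    ; ⊕-closed = λ {x} {y} x∈ y∈ →
        cong not (trans (linear x y) (cong₂ _xor_ (not≡true⇒≡false x∈) (not≡true⇒≡false y∈)))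
    }

  kernel-codimOne : ∀ {s} → f s ≡ true → CodimOne (kernel f)
  kernel-codimOne {s} fs≡true with codim≤1 ¬outside-pair (classify kernel-subspace)
    where
    ¬outside-pair : ¬ OutsidePair
    ¬outside-pair (p , q , p∉ , q∉ , p⊕q∉) = true≢false (begin
      true            ≡⟨ not≡false⇒≡true p⊕q∉ ⟨
      f (p ⊕ q)       ≡⟨ linear p q ⟩
      f p xor f q     ≡⟨ cong₂ _xor_ (not≡false⇒≡true p∉) (not≡false⇒≡true q∉) ⟩
      true xor true   ≡⟨⟩
      false           ∎)
      where open ≡-Reasoning
  ... | inj₁ all = ⊥-elim (true≢false (trans (sym fs≡true) (not≡true⇒≡false (all s))))
  ... | inj₂ H = H

module _ {m} (h : Vec (V (suc m)) m) (h-independent : Independent h) where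

  private
    spanᵇ : V (suc m) → Bool
    spanᵇ x = does (∃ᵥ? (λ c → comb h c ≟ᵥ x))

    spanᵇ-complete : ∀ {x} → InSpan h x → spanᵇ x ≡ true
    spanᵇ-complete = dec-true (∃ᵥ? _)

    spanᵇ-sound : ∀ {x} → spanᵇ x ≡ true → InSpan h x
    spanᵇ-sound = does-sound (∃ᵥ? _)

    spanᵇ-subspace : IsSubspace spanᵇ
    spanᵇ-subspace = record
      { 0v∈ = spanᵇ-complete (0v , comb-0v h)
      ; ⊕-closed = λ x∈ y∈ →
          let c , c↦x = spanᵇ-sound x∈ ; d , d↦y = spanᵇ-sound y∈
          in spanᵇ-complete (c ⊕ d , trans (comb-⊕ h c d) (cong₂ _⊕_ c↦x d↦y))
      }

    ¬outside-pair : ¬ OutsidePair {Z = spanᵇ}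
    ¬outside-pair (p , q , p∉ , q∉ , p⊕q∉) = 1+n≰n (independent⇒≤ {b = p ∷ q ∷ h} p∷q∷h-independent)
      where
      split : ∀ {c₀ c₁ c} → comb (p ∷ q ∷ h) (c₀ ∷ c₁ ∷ c) ≡ 0v → comb (p ∷ q ∷ []) (c₀ ∷ c₁ ∷ []) ≡ comb h c
      split {c₀} {c₁} {c} eq = ⊕≡0⇒≡ _ _ (trans (sym (comb-++ (p ∷ q ∷ []) h (c₀ ∷ c₁ ∷ []) c)) eq)
      p∷q∷h-independent : Independent (p ∷ q ∷ h)
      p∷q∷h-independent (c₀ ∷ c₁ ∷ c) eq with (c₀ ∷ c₁ ∷ []) ≟ᵥ 0v
      ... | yes refl = cong (λ c → false ∷ false ∷ c) (h-independent c (trans (sym (split eq)) (comb-0v (p ∷ q ∷ []))))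
      ... | no c≢0 = ⊥-elim (true≢false (trans (sym (spanᵇ-complete (c , sym (split eq))))
                                               (pair-span-outside {Z = spanᵇ} p∉ q∉ p⊕q∉ (c₀ ∷ c₁ ∷ []) c≢0)))

  hyperplane-complement : ∃ λ u → ¬ InSpan h u × (∀ x → InSpan h x ⊎ InSpan h (x ⊕ u))
  hyperplane-complement with codim≤1 ¬outside-pair (classify spanᵇ-subspace)
  ... | inj₁ all = ⊥-elim (1+n≰n (spanning⇒≥ {b = h} (λ x → spanᵇ-sound (all x))))
  ... | inj₂ H = complement , (λ u∈ → true≢false (trans (sym (spanᵇ-complete u∈)) complement∉)) , covers↓
    where
    open CodimOne H
    covers↓ : ∀ x → InSpan h x ⊎ InSpan h (x ⊕ complement)
    covers↓ x with covers x
    ... | inj₁ x∈ = inj₁ (spanᵇ-sound x∈)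
    ... | inj₂ x⊕u∈ = inj₂ (spanᵇ-sound x⊕u∈)

-- Flats avoiding E, and semidoublings

symDiff⇔xor : ∀ {P Q R : Set} {α β} → Q → P ⇔ (α ≡ true) → R ⇔ (β ≡ false) →
  (((P × Q) × ¬ (Q × ¬ R)) ⊎ (¬ (P × Q) × (Q × ¬ R))) ⇔ (α xor β ≡ true)
symDiff⇔xor {α = true} {false} q P⇔ R⇔ =
  mk⇔ (λ _ → refl) (λ _ → inj₁ ((from P⇔ refl , q) , λ (_ , ¬r) → ¬r (from R⇔ refl)))
  where open Equivalence
symDiff⇔xor {α = true} {true} q P⇔ R⇔ = mk⇔ to′ λ ()
  where
  open Equivalence
  to′ : _ → false ≡ true
  to′ (inj₁ (_ , ¬[q×¬r])) = ⊥-elim (¬[q×¬r] (q , true≢false ∘ to R⇔))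
  to′ (inj₂ (¬[p×q] , _)) = ⊥-elim (¬[p×q] (from P⇔ refl , q))
symDiff⇔xor {α = false} {false} q P⇔ R⇔ = mk⇔ to′ λ ()
  where
  open Equivalence
  to′ : _ → false ≡ true
  to′ (inj₁ ((p , _) , _)) = ⊥-elim (true≢false (sym (to P⇔ p)))
  to′ (inj₂ (_ , _ , ¬r)) = ⊥-elim (¬r (from R⇔ refl))
symDiff⇔xor {α = false} {true} q P⇔ R⇔ =
  mk⇔ (λ _ → refl) (λ _ → inj₂ ((λ (p , _) → true≢false (sym (to P⇔ p))) , q , true≢false ∘ to R⇔))
  where open Equivalence

empty-flat : ∀ {n} (M : Matroid n) → HasFlatAvoidingE M 0
empty-flat M = [] , (λ { [] _ → refl }) , λ { _ (([] , refl) , 0≢0) → ⊥-elim (0≢0 refl) }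

χ≥3⇒3≤n : ∀ {n} (M : Matroid n) → ChiAtLeast3 M → 3 ≤ n
χ≥3⇒3≤n {n} M χ≥3 = ≮⇒≥ λ n<3 → χ≥3 n n<3 ≤-refl (subst (HasFlatAvoidingE M) (sym (n∸n≡0 n)) (empty-flat M))

avoiding-flat : ∀ {n k d} (M : Matroid n) (b : Vec (V n) k) → k ≡ d → Independent b →
                (∀ c → E M (comb b c) ≡ false) → HasFlatAvoidingE M d
avoiding-flat M b refl b-independent avoids = b , b-independent , λ { _ ((c , refl) , _) → avoids c }

-- The `InSymDiff` of `IsSemidoublingOf` is local to its where-block; this copy agrees with
-- it definitionally.
SymDiff : ∀ {n k l} (M : Matroid n) → Vec (V n) k → Vec (V n) l → V n → Set
SymDiff M h h₀ y = ((E M y ≡ true × InFlat h y) × ¬ (InFlat h y × ¬ InFlat h₀ y))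
                 ⊎ (¬ (E M y ≡ true × InFlat h y) × (InFlat h y × ¬ InFlat h₀ y))

SemidoublingRHS : ∀ {n k l} (M : Matroid n) → Vec (V n) k → Vec (V n) l → V n → V n → Set
SemidoublingRHS M h h₀ w x = (E M x ≡ true × InFlat h x) ⊎ (∃ λ y → x ≡ w ⊕ y × SymDiff M h h₀ y)

symDiff⇒inFlat : ∀ {n k l} {M : Matroid n} {h : Vec (V n) k} {h₀ : Vec (V n) l} {y} → SymDiff M h h₀ y → InFlat h y
symDiff⇒inFlat (inj₁ ((_ , y∈H) , _)) = y∈H
symDiff⇒inFlat (inj₂ (_ , y∈H , _)) = y∈H

semidoubling-intro : ∀ {m k} {M : Matroid (suc m)} {h : Vec (V (suc m)) m} → k ≡ m ∸ 1 →
  (w : V (suc m)) (h₀ : Vec (V (suc m)) k) → w ≢ 0v → ¬ InFlat h w → E M w ≡ false →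
  Independent h₀ → (∀ x → InFlat h₀ x → InFlat h x) →
  (∀ x → E M x ≡ true ⇔ SemidoublingRHS M h h₀ w x) → IsSemidoublingOf M h
semidoubling-intro refl w h₀ w≢0 w∉H w∉E h₀-independent H₀⊆H E⇔ =
  w , h₀ , w≢0 , w∉H , w∉E , h₀-independent , H₀⊆H , λ x → Equivalence.to (E⇔ x) , Equivalence.from (E⇔ x)

-- A fixed hyperplane H

module Semidoubling {m} (M : Matroid (suc m)) (even-flats : In𝓔₃ M) (χ≥3 : ChiAtLeast3 M)
  (h : Vec (V (suc m)) m) (h-independent : Independent h)
  (u : V (suc m)) (u∉H : ¬ InSpan h u) (H-covers : ∀ x → InSpan h x ⊎ InSpan h (x ⊕ u)) where

  ι : V m → V (suc m)
  ι = comb h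

  ι-linear : IsLinear ι
  ι-linear = comb-isLinear h

  map-ι-independent : ∀ {k} (K : Vec (V m) k) → Independent K → Independent (Data.Vec.map ι K)
  map-ι-independent K K-independent c eq =
    K-independent c (comb-injective h h-independent (trans (sym (comb-map ι-linear K c)) (trans eq (sym (comb-0v h)))))

  E₀ E₁ : V m → Bool
  E₀ s = E M (ι s)
  E₁ s = E M (u ⊕ ι s)

  E₀-0v : E₀ 0v ≡ false
  E₀-0v = trans (cong (E M) (comb-0v h)) (E-0 M)

  E-map-ι : ∀ {k} (K : Vec (V m) k) c → E M (comb (Data.Vec.map ι K) c) ≡ E₀ (comb K c)
  E-map-ι K c = cong (E M) (comb-map ι-linear K c)

  u⊕ι⊕ι : ∀ a s → (u ⊕ ι a) ⊕ ι s ≡ u ⊕ ι (a ⊕ s)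
  u⊕ι⊕ι a s = trans (⊕-assoc u (ι a) (ι s)) (cong (u ⊕_) (sym (comb-⊕ h a s)))

  u⊕ι∉H : ∀ s → ¬ InSpan h (u ⊕ ι s)
  u⊕ι∉H s (c , ιc≡u⊕ιs) = u∉H (c ⊕ s , trans (comb-⊕ h c s) (trans (cong (_⊕ ι s) ιc≡u⊕ιs) (⊕-cancelʳ u (ι s))))

  u⊕ι≢0 : ∀ s → u ⊕ ι s ≢ 0v
  u⊕ι≢0 s eq = u⊕ι∉H s (0v , trans (comb-0v h) (sym eq))

  2≤n : 2 ≤ suc m
  2≤n = ≤-trans (n≤1+n 2) (χ≥3⇒3≤n M χ≥3)

  ¬avoiding-hyperplane : ∀ {k} (b : Vec (V (suc m)) k) → k ≡ m → Independent b → ¬ (∀ c → E M (comb b c) ≡ false)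
  ¬avoiding-hyperplane b k≡m b-independent avoids =
    χ≥3 1 (s≤s (s≤s z≤n)) (≤-trans (n≤1+n 1) 2≤n) (avoiding-flat M b k≡m b-independent avoids)

  ¬avoiding-codim2 : ∀ {r} (b : Vec (V (suc m)) r) → suc r ≡ m → Independent b → ¬ (∀ c → E M (comb b c) ≡ false)
  ¬avoiding-codim2 b sr≡m b-independent avoids =
    χ≥3 2 (s≤s (s≤s (s≤s z≤n))) 2≤n (avoiding-flat M b (cong (_∸ 1) sr≡m) b-independent avoids)

  E₀-nonzero : ¬ (∀ s → E₀ s ≡ false)
  E₀-nonzero = ¬avoiding-hyperplane h refl h-independent

  E₀-flat-parity : ∀ (t : Vec (V m) 3) → Independent t → xorSum (λ c → E₀ (comb t c)) (allVec 3) ≡ false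
  E₀-flat-parity t t-independent = trans (sym (xorSum-cong (E-map-ι t) (allVec 3)))
    (flat-parity M (Data.Vec.map ι t) ιt-independent (even-flats 3 ≤-refl (Data.Vec.map ι t) ιt-independent))
    where ιt-independent = map-ι-independent t t-independent

  coset-family : ∀ {k} → V m → Vec (V m) k → Vec (V (suc m)) (suc k)
  coset-family a K = (u ⊕ ι a) ∷ Data.Vec.map ι K

  module _ (a : V m) {k} (K : Vec (V m) k) where

    comb-coset-family : ∀ c₀ c → comb (coset-family a K) (c₀ ∷ c) ≡ scale c₀ (u ⊕ ι a) ⊕ ι (comb K c)
    comb-coset-family c₀ c = cong (scale c₀ (u ⊕ ι a) ⊕_) (comb-map ι-linear K c)

    E-coset-family-false : ∀ c → E M (comb (coset-family a K) (false ∷ c)) ≡ E₀ (comb K c)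
    E-coset-family-false c = cong (E M) (trans (comb-coset-family false c) (⊕-identityˡ _))

    E-coset-family-true : ∀ c → E M (comb (coset-family a K) (true ∷ c)) ≡ E₁ (a ⊕ comb K c)
    E-coset-family-true c = cong (E M) (trans (comb-coset-family true c) (u⊕ι⊕ι a (comb K c)))

    coset-family-independent : Independent K → Independent (coset-family a K)
    coset-family-independent K-independent (true ∷ c) eq =
      ⊥-elim (u⊕ι≢0 (a ⊕ comb K c) (trans (sym (trans (comb-coset-family true c) (u⊕ι⊕ι a (comb K c)))) eq))
    coset-family-independent K-independent (false ∷ c) eq =
      cong (false ∷_) (map-ι-independent K K-independent c (trans (sym (⊕-identityˡ _)) eq))

    xorSum-coset-family :
      xorSum (λ c → E M (comb (coset-family a K) c)) (allVec (suc k))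
      ≡ xorSum (λ c → E₀ (comb K c)) (allVec k) xor xorSum (λ c → E₁ (a ⊕ comb K c)) (allVec k)
    xorSum-coset-family = trans (xorSum-allVec-suc {k} _)
      (cong₂ _xor_ (xorSum-cong E-coset-family-false (allVec k)) (xorSum-cong E-coset-family-true (allVec k)))

  -- For the a found in `semidoubling`, `defect a` is the indicator of H ∖ H₀ pulled back along ι.
  defect : V m → V m → Bool
  defect a s = E₁ a xor (E₀ s xor E₁ (a ⊕ s))

  defect-0v : ∀ a → defect a 0v ≡ false
  defect-0v a = begin
    E₁ a xor (E₀ 0v xor E₁ (a ⊕ 0v)) ≡⟨ cong₂ (λ z b → E₁ a xor (z xor E₁ b)) E₀-0v (⊕-identityʳ a) ⟩
    E₁ a xor E₁ a                    ≡⟨ xor-same (E₁ a) ⟩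
    false                            ∎
    where open ≡-Reasoning

  coset-pair-sum : V m → V m → V m → Bool
  coset-pair-sum a p q =
    (E₀ 0v xor (E₀ q xor (E₀ p xor E₀ (p ⊕ q)))) xor (E₁ a xor (E₁ (a ⊕ q) xor (E₁ (a ⊕ p) xor E₁ (a ⊕ (p ⊕ q)))))

  coset-pair-parity : ∀ a {p q} → Independent (p ∷ q ∷ []) → coset-pair-sum a p q ≡ false
  coset-pair-parity a {p} {q} pq-independent = begin
    (E₀ 0v xor (E₀ q xor (E₀ p xor E₀ (p ⊕ q)))) xor (E₁ a xor rest)
      ≡⟨ cong₂ _xor_ (sym (xorSum-span-pair E₀ p q))
           (trans (cong (λ v → E₁ v xor rest) (sym (⊕-identityʳ a))) (sym (xorSum-span-pair (λ s → E₁ (a ⊕ s)) p q))) ⟩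
    xorSum (λ c → E₀ (comb (p ∷ q ∷ []) c)) (allVec 2) xor xorSum (λ c → E₁ (a ⊕ comb (p ∷ q ∷ []) c)) (allVec 2)
      ≡⟨ xorSum-coset-family a (p ∷ q ∷ []) ⟨
    xorSum (λ c → E M (comb b c)) (allVec 3)
      ≡⟨ flat-parity M b b-independent (even-flats 3 ≤-refl b b-independent) ⟩
    false ∎
    where
    open ≡-Reasoning
    rest = E₁ (a ⊕ q) xor (E₁ (a ⊕ p) xor E₁ (a ⊕ (p ⊕ q)))
    b = coset-family a (p ∷ q ∷ [])
    b-independent = coset-family-independent a (p ∷ q ∷ []) pq-independent

  defect-linear : ∀ a → IsLinearFunctional (defect a)
  defect-linear a = linear-from-independent-pairs {f = defect a} (defect-0v a) additive
    where
    additive : ∀ {p q} → Independent (p ∷ q ∷ []) → defect a (p ⊕ q) ≡ defect a p xor defect a q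
    additive {p} {q} pq-independent = begin
      defect a (p ⊕ q)
        ≡⟨ solve 8 (λ z aq ap apq ba bq bp bpq →
             ba :+ (apq :+ bpq) :=
             ((ba :+ (ap :+ bp)) :+ (ba :+ (aq :+ bq))) :+
             (((z :+ (aq :+ (ap :+ apq))) :+ (ba :+ (bq :+ (bp :+ bpq)))) :+ z)) refl
             (E₀ 0v) (E₀ q) (E₀ p) (E₀ (p ⊕ q)) (E₁ a) (E₁ (a ⊕ q)) (E₁ (a ⊕ p)) (E₁ (a ⊕ (p ⊕ q))) ⟩
      (defect a p xor defect a q) xor (coset-pair-sum a p q xor E₀ 0v)
        ≡⟨ cong₂ (λ σ z → (defect a p xor defect a q) xor (σ xor z)) (coset-pair-parity a pq-independent) E₀-0v ⟩
      (defect a p xor defect a q) xor false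
        ≡⟨ xor-identityʳ _ ⟩
      defect a p xor defect a q ∎
      where open ≡-Reasoning

  ¬all-E₁ : ¬ (∀ a → E₁ a ≡ true)
  ¬all-E₁ all-E₁ with ∃ᵥ? (λ s → E₀ s ≟ᵇ true)
  ... | no none = E₀-nonzero (λ s → ¬-not (none ∘ (s ,_)))
  ... | yes (s , E₀s≡true) = ¬avoiding-codim2 (Data.Vec.map ι K) suc-dim (map-ι-independent K independent) avoids
    where
    defect-0v≡E₀ : ∀ s → defect 0v s ≡ E₀ s
    defect-0v≡E₀ s = trans (cong₂ (λ b c → b xor (E₀ s xor c)) (all-E₁ 0v) (all-E₁ (0v ⊕ s))) (true-cancel (E₀ s))
      where
      true-cancel : ∀ x → true xor (x xor true) ≡ x
      true-cancel true = refl
      true-cancel false = refl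
    E₀-linear : IsLinearFunctional E₀
    E₀-linear p q = trans (sym (defect-0v≡E₀ (p ⊕ q)))
                          (trans (defect-linear 0v p q) (cong₂ _xor_ (defect-0v≡E₀ p) (defect-0v≡E₀ q)))
    open CodimOne (kernel-codimOne {f = E₀} E₀-linear E₀s≡true)
    open Basis basis renaming (vectors to K)
    avoids : ∀ c → E M (comb (Data.Vec.map ι K) c) ≡ false
    avoids c = trans (E-map-ι K c) (not≡true⇒≡false (⊆Z c))

  module _ {a₀} (E₁a₀≡false : E₁ a₀ ≡ false) (trivial : ∀ a → E₁ a ≡ false → ∀ s → defect a s ≡ false) where

    E₁-shift : ∀ {a} → E₁ a ≡ false → ∀ s → E₁ (a ⊕ s) ≡ E₀ s
    E₁-shift {a} E₁a≡false s =
      sym (xor≡false⇒≡ (trans (cong (λ b → b xor (E₀ s xor E₁ (a ⊕ s))) (sym E₁a≡false)) (trivial a E₁a≡false s)))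

    kernel-E₀-subspace : IsSubspace (kernel E₀)
    kernel-E₀-subspace = record
      { 0v∈ = cong not E₀-0v
      ; ⊕-closed = λ {x} {y} x∈ y∈ → cong not (begin
          E₀ (x ⊕ y)        ≡⟨ E₁-shift E₁a₀≡false (x ⊕ y) ⟨
          E₁ (a₀ ⊕ (x ⊕ y)) ≡⟨ cong E₁ (⊕-assoc a₀ x y) ⟨
          E₁ ((a₀ ⊕ x) ⊕ y) ≡⟨ E₁-shift (trans (E₁-shift E₁a₀≡false x) (not≡true⇒≡false x∈)) y ⟩
          E₀ y              ≡⟨ not≡true⇒≡false y∈ ⟩
          false             ∎)
      }
      where open ≡-Reasoning

    coset-avoids : ∀ {r} (B : Basis (kernel E₀) r) c → E M (comb (coset-family a₀ (Basis.vectors B)) c) ≡ false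
    coset-avoids B (false ∷ c) = trans (E-coset-family-false a₀ (Basis.vectors B) c) (not≡true⇒≡false (Basis.⊆Z B c))
    coset-avoids B (true ∷ c) = trans (E-coset-family-true a₀ (Basis.vectors B) c)
      (trans (E₁-shift E₁a₀≡false _) (not≡true⇒≡false (Basis.⊆Z B c)))

    ¬codim≥3 : ∀ (t : Vec (V m) 3) → ¬ (∀ c → c ≢ 0v → kernel E₀ (comb t c) ≡ false)
    ¬codim≥3 t outside = true≢false (trans (sym odd) (E₀-flat-parity t t-independent))
      where
      E₀-t : ∀ c → c ≢ 0v → E₀ (comb t c) ≡ true
      E₀-t c c≢0 = not≡false⇒≡true (outside c c≢0)
      t-independent : Independent t
      t-independent c eq with c ≟ᵥ 0v
      ... | yes c≡0 = c≡0
      ... | no c≢0 = ⊥-elim (true≢false (trans (sym (E₀-t c c≢0)) (trans (cong E₀ eq) E₀-0v)))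
      odd : xorSum (λ c → E₀ (comb t c)) (allVec 3) ≡ true
      odd = xorSum-nonzero₃ _ (trans (cong E₀ (comb-0v t)) E₀-0v) E₀-t

    ¬trivial-defects : ⊥
    ¬trivial-defects with classify kernel-E₀-subspace
    ... | codim0 _ all = E₀-nonzero (λ s → not≡true⇒≡false (all s))
    ... | codim1 H = ¬avoiding-hyperplane (coset-family a₀ K) suc-dim
                       (coset-family-independent a₀ K independent) (coset-avoids basis)
      where
      open CodimOne H
      open Basis basis renaming (vectors to K)
    ... | codim2 ssr≡m B _ _ _ _ _ = ¬avoiding-codim2 (coset-family a₀ K) ssr≡m
                                       (coset-family-independent a₀ K independent) (coset-avoids B)
      where open Basis B renaming (vectors to K)
    ... | codim≥3 t outside = ¬codim≥3 t outside

  module _ {a} (E₁a≡false : E₁ a ≡ false) (H₀ : CodimOne (kernel (defect a))) where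
    open CodimOne H₀ using (suc-dim; basis)
    open Basis basis renaming (vectors to K)

    w : V (suc m)
    w = u ⊕ ι a

    h₀ : Vec (V (suc m)) (CodimOne.dim H₀)
    h₀ = Data.Vec.map ι K

    E-w⊕ι : ∀ s → E M (w ⊕ ι s) ≡ E₀ s xor defect a s
    E-w⊕ι s = begin
      E M (w ⊕ ι s)                   ≡⟨ cong (E M) (u⊕ι⊕ι a s) ⟩
      E₁ (a ⊕ s)                      ≡⟨ xor-cancelˡ (E₀ s) _ ⟨
      E₀ s xor (E₀ s xor E₁ (a ⊕ s))  ≡⟨ cong (λ b → E₀ s xor (b xor (E₀ s xor E₁ (a ⊕ s)))) E₁a≡false ⟨
      E₀ s xor defect a s             ∎
      where open ≡-Reasoning

    H₀-membership : ∀ s → ι s ≢ 0v → InFlat h₀ (ι s) ⇔ (defect a s ≡ false)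
    H₀-membership s ιs≢0 = mk⇔ to′ from′
      where
      to′ : InFlat h₀ (ι s) → defect a s ≡ false
      to′ ((c , c↦ιs) , _) = not≡true⇒≡false (subst (λ v → kernel (defect a) v ≡ true)
        (comb-injective h h-independent (trans (sym (comb-map ι-linear K c)) c↦ιs)) (⊆Z c))
      from′ : defect a s ≡ false → InFlat h₀ (ι s)
      from′ d≡false = let c , c↦s = spans s (cong not d≡false) in
        (c , trans (comb-map ι-linear K c) (cong ι c↦s)) , ιs≢0

    symDiff-ι : ∀ s → ι s ≢ 0v → SymDiff M h h₀ (ι s) ⇔ (E₀ s xor defect a s ≡ true)
    symDiff-ι s ιs≢0 = symDiff⇔xor ((s , refl) , ιs≢0) (mk⇔ id id) (H₀-membership s ιs≢0)

    E⇒RHS : ∀ x → E M x ≡ true → SemidoublingRHS M h h₀ w x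
    E⇒RHS x Ex with H-covers x
    ... | inj₁ x∈H = inj₁ (Ex , x∈H , λ x≡0 → true≢false (trans (sym Ex) (trans (cong (E M) x≡0) (E-0 M))))
    ... | inj₂ (c , ιc≡x⊕u) =
      inj₂ (ι s , x≡w⊕ιs , Equivalence.from (symDiff-ι s ιs≢0) (trans (sym (E-w⊕ι s)) (trans (cong (E M) (sym x≡w⊕ιs)) Ex)))
      where
      s = a ⊕ c
      x≡w⊕ιs : x ≡ w ⊕ ι s
      x≡w⊕ιs = begin
        x                   ≡⟨ ⊕-cancelʳ x u ⟨
        (x ⊕ u) ⊕ u         ≡⟨ cong (_⊕ u) ιc≡x⊕u ⟨
        ι c ⊕ u             ≡⟨ ⊕-comm (ι c) u ⟩
        u ⊕ ι c             ≡⟨ cong (λ v → u ⊕ ι v) (⊕-cancelˡ a c) ⟨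
        u ⊕ ι (a ⊕ (a ⊕ c)) ≡⟨ u⊕ι⊕ι a s ⟨
        w ⊕ ι s             ∎
        where open ≡-Reasoning
      ιs≢0 : ι s ≢ 0v
      ιs≢0 ιs≡0 = true≢false (trans (sym Ex)
        (trans (cong (E M) (trans x≡w⊕ιs (trans (cong (w ⊕_) ιs≡0) (⊕-identityʳ w)))) E₁a≡false))

    RHS⇒E : ∀ x → SemidoublingRHS M h h₀ w x → E M x ≡ true
    RHS⇒E x (inj₁ (Ex , _)) = Ex
    RHS⇒E x (inj₂ (y , x≡w⊕y , y∈Δ)) with symDiff⇒inFlat {M = M} {h = h} {h₀ = h₀} y∈Δ
    ... | (s , refl) , ιs≢0 =
      trans (cong (E M) x≡w⊕y) (trans (E-w⊕ι s) (Equivalence.to (symDiff-ι s ιs≢0) y∈Δ))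

    semidoubling-at : IsSemidoublingOf M h
    semidoubling-at =
      semidoubling-intro {M = M} {h = h} (cong (_∸ 1) suc-dim) w h₀ (u⊕ι≢0 a) (λ (w∈H , _) → u⊕ι∉H a w∈H) E₁a≡false
        (map-ι-independent K independent) H₀⊆H (λ x → mk⇔ (E⇒RHS x) (RHS⇒E x))
      where
      H₀⊆H : ∀ x → InFlat h₀ x → InFlat h x
      H₀⊆H x ((c , c↦x) , x≢0) = (comb K c , trans (sym (comb-map ι-linear K c)) c↦x) , x≢0

  semidoubling : IsSemidoublingOf M h
  semidoubling with ∃ᵥ? (λ a → (E₁ a ≟ᵇ false) ×-dec ∃ᵥ? (λ s → defect a s ≟ᵇ true))
  ... | yes (a , E₁a≡false , _ , defect≡true) =
    semidoubling-at E₁a≡false (kernel-codimOne (defect-linear a) defect≡true)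
  ... | no ¬good with ∃ᵥ? (λ a → E₁ a ≟ᵇ false)
  ...   | yes (_ , E₁a₀≡false) =
    ⊥-elim (¬trivial-defects E₁a₀≡false λ a E₁a≡false s → ¬-not λ d → ¬good (a , E₁a≡false , s , d))
  ...   | no ¬any = ⊥-elim (¬all-E₁ λ a → ¬-not (¬any ∘ (a ,_)))

corollary4p2 : ∀ (n : ℕ) (M : Matroid n) → In𝓔₃ M → ChiAtLeast3 M →
    ∀ (h : Vec (V n) (n ∸ 1)) → Independent h → IsSemidoublingOf M h
corollary4p2 zero M _ χ≥3 with χ≥3⇒3≤n M χ≥3
... | ()
corollary4p2 (suc m) M even-flats χ≥3 h h-independent =
  let u , u∉H , H-covers = hyperplane-complement h h-independent
  in Semidoubling.semidoubling M even-flats χ≥3 h h-independent u u∉H H-covers
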